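{- Let $k\ge 3$ and $n\ge 0$. The word $W^{(k)}_n$ does not contain the factor $00$.
   Context: The alphabet is $\mathbb{N}=\{0,1,2,\dots\}$. For an integer $k\ge 3$, $\varphi_k$ is the morphism of $\mathbb{N}^*$ defined on letters, for $i\ge 0$ and $0\le j\le k-1$, by $\varphi_k(ki+j)=(ki)(ki+j+1)$ (two letters) if $0\le j\le k-2$, and $\varphi_k(ki+k-1)=(ki+k)$ (one letter). For $n\ge 0$, $W^{(k)}_n=\varphi_k^n(0)$. -}

module Defs where

open import Data.Nat using (ℕ; zero; suc; _+_; _*_; _∸_; _≡ᵇ_; NonZero)
open import Data.Nat.DivMod using (_/_; _%_)
open import Data.List using (List; []; _∷_; _++_; concatMap)
open import Data.Bool using (if_then_else_)

φletter : (k : ℕ) → .{{NonZero k}} → ℕ → List ℕ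
φletter k a =
  let i = a / k
      j = a % k
  in if j ≡ᵇ (k ∸ 1)
     then (k * i + k) ∷ []
     else (k * i) ∷ (k * i + j + 1) ∷ []

φ : (k : ℕ) → .{{NonZero k}} → List ℕ → List ℕ
φ k = concatMap (φletter k)

φ^ : (k : ℕ) → .{{NonZero k}} → ℕ → List ℕ → List ℕ
φ^ k zero    w = w
φ^ k (suc n) w = φ k (φ^ k n w)

W : (k : ℕ) → .{{NonZero k}} → ℕ → List ℕ
W k n = φ^ k n (0 ∷ [])

-- Every image φ_k(a) is either one nonzero letter or a pair whose second letter
-- is nonzero, so in φ_k(w) each 0 is immediately followed by a nonzero letter;
-- hence W_n = φ_k(W_{n-1}) contains no factor 00 for n ≥ 1, and W_0 = 0 is too short.
module Submission where

open import Defs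
open import Data.Nat using (ℕ; zero; suc; _+_; _*_; _≡ᵇ_; NonZero)
open import Data.Nat.Properties using (m+1+n≢0)
open import Data.Nat.DivMod using (_/_; _%_)
open import Data.List using (List; []; _∷_; _++_)
open import Data.List.Properties using (∷-injectiveʳ)
open import Data.Bool using (true; false)
open import Data.Product using (∃₂; _,_)
open import Relation.Binary.PropositionalEquality using (_≡_; _≢_; refl)
open import Relation.Nullary using (¬_)

data ZerosGuarded : List ℕ → Set where
  []            : ZerosGuarded []
  nonzero∷      : ∀ {x xs} → x ≢ 0 → ZerosGuarded xs → ZerosGuarded (x ∷ xs)
  zero-nonzero∷ : ∀ {y xs} → y ≢ 0 → ZerosGuarded xs → ZerosGuarded (0 ∷ y ∷ xs)

guarded-pair : ∀ x {y xs} → y ≢ 0 → ZerosGuarded xs → ZerosGuarded (x ∷ y ∷ xs)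
guarded-pair zero    y≢0 g = zero-nonzero∷ y≢0 g
guarded-pair (suc x) y≢0 g = nonzero∷ (λ ()) (nonzero∷ y≢0 g)

guarded⇒no-00 : ∀ u {v w} → ZerosGuarded w → w ≢ u ++ 0 ∷ 0 ∷ v
guarded⇒no-00 []      (nonzero∷ x≢0 _)      refl = x≢0 refl
guarded⇒no-00 []      (zero-nonzero∷ y≢0 _) refl = y≢0 refl
guarded⇒no-00 (_ ∷ u) (nonzero∷ _ g)        eq   = guarded⇒no-00 u g (∷-injectiveʳ eq)
guarded⇒no-00 (_ ∷ u) (zero-nonzero∷ y≢0 g) eq   = guarded⇒no-00 u (nonzero∷ y≢0 g) (∷-injectiveʳ eq)

φletter-guarded : ∀ k .{{_ : NonZero k}} a {xs} → ZerosGuarded xs → ZerosGuarded (φletter k a ++ xs)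
φletter-guarded (suc k) a g with a % suc k ≡ᵇ k
... | true  = nonzero∷ (m+1+n≢0 (suc k * (a / suc k))) g
... | false = guarded-pair (suc k * (a / suc k)) (m+1+n≢0 (suc k * (a / suc k) + a % suc k) {0}) g

φ-guarded : ∀ k .{{_ : NonZero k}} w → ZerosGuarded (φ k w)
φ-guarded k []      = []
φ-guarded k (a ∷ w) = φletter-guarded k a (φ-guarded k w)

lemma3p4 : (m n : ℕ) →
    ¬ ∃₂ λ (u v : List ℕ) → W (3 + m) n ≡ u ++ (0 ∷ 0 ∷ v)
lemma3p4 m zero    ([]        , v , ())
lemma3p4 m zero    (_ ∷ []    , v , ())
lemma3p4 m zero    (_ ∷ _ ∷ _ , v , ())
lemma3p4 m (suc n) (u , v , eq) = guarded⇒no-00 u (φ-guarded (3 + m) (W (3 + m) n)) eq
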